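{- Let $A(z)=\sum_{n\ge0}|\mathbf{I}_n(\underline{10}0)|z^n=\sum_{n\ge0}|\mathbf{I}_n(\underline{10}1)|z^n$. Then $A(z)=G(1,z)$, where $G(u,z)$ is the formal power series in $u$ and $z$ defined recursively by $$G(u,z)=u(1-u)+u\,G\big(u(1+z-uz),z\big).$$
   Context: $\mathbf{I}_n$ is the set of integer sequences $e_1\dots e_n$ with $0\le e_i<i$ ($\mathbf{I}_0$ contains only the empty sequence). $\mathbf{I}_n(\underline{10}0)$ is the set of $e\in\mathbf{I}_n$ with no positions $i,k$, $i+1<k$, with $e_i>e_{i+1}=e_k$; $\mathbf{I}_n(\underline{10}1)$ is the set of $e\in\mathbf{I}_n$ with no positions $i,k$, $i+1<k$, with $e_i=e_k>e_{i+1}$. (The two sequences of cardinalities coincide.) -}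

module Defs where

open import Data.Nat using (ℕ; zero; suc; _∸_; _<ᵇ_; _≡ᵇ_)
open import Data.Bool using (Bool; true; false; _∧_; _∨_; not)
open import Data.List using (List; []; _∷_; _++_; [_]; map; concatMap; upTo; filter; length)
open import Data.Bool.ListAction using (any)
open import Data.Integer using (ℤ; +_; _+_; _*_; -_; _-_)
open import Data.Bool using (T)
open import Data.Bool.Properties using (T?)

-- Inversion sequences.  A sequence e₁…eₙ is represented as the list
-- (e₁ ∷ … ∷ eₙ ∷ []).  invSeqs n enumerates 𝐈ₙ (each element once):
-- e_{n+1} ranges over 0,…,n.

invSeqs : ℕ → List (List ℕ)
invSeqs zero    = [] ∷ []
invSeqs (suc n) = concatMap (λ e → map (λ x → e ++ [ x ]) (upTo (suc n))) (invSeqs n)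

contains100 : List ℕ → Bool
contains100 (x ∷ y ∷ rest) = ((y <ᵇ x) ∧ any (λ w → w ≡ᵇ y) rest) ∨ contains100 (y ∷ rest)
contains100 _              = false

contains101 : List ℕ → Bool
contains101 (x ∷ y ∷ rest) = ((y <ᵇ x) ∧ any (λ w → w ≡ᵇ x) rest) ∨ contains101 (y ∷ rest)
contains101 _              = false

count100 : ℕ → ℕ
count100 n = length (filter (λ e → T? (not (contains100 e))) (invSeqs n))

count101 : ℕ → ℕ
count101 n = length (filter (λ e → T? (not (contains101 e))) (invSeqs n))

-- Formal power series in u and z with integer coefficients:
-- F i n is the coefficient of uⁱ zⁿ.

Series : Set
Series = ℕ → ℕ → ℤ

sumTo : ℕ → (ℕ → ℤ) → ℤ
sumTo zero    f = f 0
sumTo (suc N) f = sumTo N f + f (suc N)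

_⊕_ : Series → Series → Series
(F ⊕ H) i n = F i n + H i n

_⊖_ : Series → Series → Series
(F ⊖ H) i n = F i n - H i n

_⊛_ : Series → Series → Series
(F ⊛ H) i n = sumTo i (λ a → sumTo n (λ b → F a b * H (i ∸ a) (n ∸ b)))

infixl 6 _⊕_ _⊖_
infixl 7 _⊛_

oneS : Series
oneS zero zero = + 1
oneS _    _    = + 0

U : Series
U (suc zero) zero = + 1
U _          _    = + 0

Z : Series
Z zero (suc zero) = + 1
Z _    _          = + 0

pow : Series → ℕ → Series
pow W zero    = oneS
pow W (suc a) = W ⊛ pow W a

-- Substitution u ↦ W in F, i.e. F(W, z) = Σ_{a,b} F a b · Wᵃ · zᵇ.
-- This is the genuine substitution whenever W has no u⁰-terms
-- (then Wᵃ only has u-degrees ≥ a, so only a ≤ i contributes to uⁱ).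
substU : Series → Series → Series
substU F W i n = sumTo i (λ a → sumTo n (λ b → F a b * pow W a i (n ∸ b)))

IsG : Series → Set
IsG G = ∀ i n → G i n ≡ (U ⊛ (oneS ⊖ U) ⊕ U ⊛ substU G (U ⊛ (oneS ⊕ Z ⊖ U ⊛ Z))) i n
  where open import Relation.Binary.PropositionalEquality using (_≡_)

module Submission where

-- Both classes grow along one generating tree.  Label an avoiding sequence e
-- of length n by (t , p): t values x ≤ n can be appended to e without
-- creating an occurrence, p of them lie below the last entry.  Appending the
-- r-th allowed value gives the label (t , r) when r < p (a descent, which
-- forbids one more value) and (t + 1 , r) otherwise.

open import Defs
open import Data.Nat using (ℕ; _<_)
open import Data.Integer using (ℤ; +_)
open import Data.Product using (Σ; _×_)
open import Relation.Binary.PropositionalEquality using (_≡_)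

open import Data.Nat as ℕ using (zero; suc; _≤_; z≤n; s≤s; _∸_; _<ᵇ_; _≡ᵇ_)
open import Data.Nat.Properties as ℕP using ()
open import Data.Nat.Combinatorics using (_C_; nCk+nC[k+1]≡[n+1]C[k+1])
open import Data.Integer using (_+_; _*_; _-_)
open import Data.Integer.Properties as ℤP using ()
open import Data.Integer.Tactic.RingSolver using (solve-∀)
open import Data.Product using (_,_; proj₁; proj₂)
open import Data.Sum using (inj₁; inj₂)
open import Data.Empty using (⊥-elim)
open import Data.Nat.Induction using (<-rec)
open import Data.Bool using (Bool; true; false; if_then_else_; T; _∧_; _∨_; not)
open import Data.Bool.Properties as 𝔹P using (T?)
open import Data.Bool.ListAction using (any)
open import Data.Bool.Solver using (module ∨-∧-Solver)
open import Function using (_∘_)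
open import Data.List using (List; []; _∷_; _++_; [_]; map; concatMap; upTo; length; filterᵇ)
open import Data.List.Properties as ℒP using ()
open import Data.List.Relation.Unary.All as All using (All; []; _∷_)
open import Data.List.Relation.Unary.All.Properties as AllP using ()
open import Relation.Binary.PropositionalEquality
  using (_≢_; refl; sym; trans; cong; cong₂; subst; module ≡-Reasoning)

sumTo-cong : ∀ N {f g : ℕ → ℤ} → (∀ k → k ≤ N → f k ≡ g k) → sumTo N f ≡ sumTo N g
sumTo-cong zero    f≡g = f≡g 0 z≤n
sumTo-cong (suc N) f≡g =
  cong₂ _+_ (sumTo-cong N (λ k k≤N → f≡g k (ℕP.m≤n⇒m≤1+n k≤N))) (f≡g (suc N) ℕP.≤-refl)

sumTo-cong′ : ∀ N {f g : ℕ → ℤ} → (∀ k → f k ≡ g k) → sumTo N f ≡ sumTo N g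
sumTo-cong′ N f≡g = sumTo-cong N (λ k _ → f≡g k)

sumTo-zero : ∀ N {f : ℕ → ℤ} → (∀ k → k ≤ N → f k ≡ + 0) → sumTo N f ≡ + 0
sumTo-zero zero    f≡0 = f≡0 0 z≤n
sumTo-zero (suc N) f≡0 =
  cong₂ _+_ (sumTo-zero N (λ k k≤N → f≡0 k (ℕP.m≤n⇒m≤1+n k≤N))) (f≡0 (suc N) ℕP.≤-refl)

sumTo-single : ∀ N k {f : ℕ → ℤ} → k ≤ N → (∀ j → j ≢ k → f j ≡ + 0) → sumTo N f ≡ f k
sumTo-single zero    zero    _   _   = refl
sumTo-single (suc N) k {f} k≤1+N off with ℕP.m≤n⇒m<n∨m≡n k≤1+N
... | inj₁ (s≤s k≤N) =
  trans (cong (λ x → sumTo N f + x) (off (suc N) (ℕP.>⇒≢ (s≤s k≤N))))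
        (trans (ℤP.+-identityʳ _) (sumTo-single N k k≤N off))
... | inj₂ refl =
  trans (cong (_+ f (suc N)) (sumTo-zero N (λ j j≤N → off j (ℕP.<⇒≢ (s≤s j≤N)))))
        (ℤP.+-identityˡ _)

sumTo-head : ∀ N (f : ℕ → ℤ) → sumTo (suc N) f ≡ f 0 + sumTo N (λ k → f (suc k))
sumTo-head zero    f = refl
sumTo-head (suc N) f =
  trans (cong (_+ f (suc (suc N))) (sumTo-head N f))
        (ℤP.+-assoc (f 0) (sumTo N (λ k → f (suc k))) (f (suc (suc N))))

sumTo-+ : ∀ N (f g : ℕ → ℤ) → sumTo N (λ k → f k + g k) ≡ sumTo N f + sumTo N g
sumTo-+ zero    f g = refl
sumTo-+ (suc N) f g =
  trans (cong (_+ (f (suc N) + g (suc N))) (sumTo-+ N f g))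
        (interchange (sumTo N f) (sumTo N g) (f (suc N)) (g (suc N)))
  where
  interchange : ∀ (a b c d : ℤ) → (a + b) + (c + d) ≡ (a + c) + (b + d)
  interchange = solve-∀

sumTo-- : ∀ N (f g : ℕ → ℤ) → sumTo N (λ k → f k - g k) ≡ sumTo N f - sumTo N g
sumTo-- zero    f g = refl
sumTo-- (suc N) f g =
  trans (cong (_+ (f (suc N) - g (suc N))) (sumTo-- N f g))
        (interchange (sumTo N f) (sumTo N g) (f (suc N)) (g (suc N)))
  where
  interchange : ∀ (a b c d : ℤ) → (a - b) + (c - d) ≡ (a + c) - (b + d)
  interchange = solve-∀

sumTo-swap : ∀ N M (f : ℕ → ℕ → ℤ) →
             sumTo N (λ a → sumTo M (f a)) ≡ sumTo M (λ b → sumTo N (λ a → f a b))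
sumTo-swap zero    M f = refl
sumTo-swap (suc N) M f =
  trans (cong (_+ sumTo M (f (suc N))) (sumTo-swap N M f))
        (sym (sumTo-+ M (λ b → sumTo N (λ a → f a b)) (f (suc N))))

-- Polynomials in u, as coefficient sequences: g j is the coefficient of uʲ.

Poly : Set
Poly = ℕ → ℤ

1ₚ : Poly
1ₚ zero    = + 1
1ₚ (suc j) = + 0

u^_·_ : ℕ → Poly → Poly
(u^ zero  · g) j       = g j
(u^ suc t · g) zero    = + 0
(u^ suc t · g) (suc j) = (u^ t · g) j

[1-u]^_ : ℕ → Poly
[1-u]^ zero            = 1ₚ
([1-u]^ suc m) j = ([1-u]^ m) j - (u^ 1 · [1-u]^ m) j

u^-below : ∀ t {j} (g : Poly) → j < t → (u^ t · g) j ≡ + 0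
u^-below (suc t) {zero}  g _           = refl
u^-below (suc t) {suc j} g (s≤s j<t) = u^-below t g j<t

u^-at : ∀ t (g : Poly) → (u^ t · g) t ≡ g 0
u^-at zero    g = refl
u^-at (suc t) g = u^-at t g

u^-off : ∀ t {j} → j ≢ t → (u^ t · 1ₚ) j ≡ + 0
u^-off zero    {zero}  j≢t = ⊥-elim (j≢t refl)
u^-off zero    {suc j} _   = refl
u^-off (suc t) {zero}  _   = refl
u^-off (suc t) {suc j} j≢t = u^-off t (λ j≡t → j≢t (cong suc j≡t))

u^-scale : ∀ t (k : ℤ) (g : Poly) j → (u^ t · (λ i → k * g i)) j ≡ k * (u^ t · g) j
u^-scale zero    k g j       = refl
u^-scale (suc t) k g zero    = sym (ℤP.*-zeroʳ k)
u^-scale (suc t) k g (suc j) = u^-scale t k g j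

u^-- : ∀ t (f g : Poly) j → (u^ t · (λ i → f i - g i)) j ≡ (u^ t · f) j - (u^ t · g) j
u^-- zero    f g j       = refl
u^-- (suc t) f g zero    = refl
u^-- (suc t) f g (suc j) = u^-- t f g j

u^-comm : ∀ t (g : Poly) j → (u^ t · (u^ 1 · g)) j ≡ (u^ suc t · g) j
u^-comm zero    g j       = refl
u^-comm (suc t) g zero    = refl
u^-comm (suc t) g (suc j) = u^-comm t g j

uShift : Series → Series
uShift X i n = (u^ 1 · (λ j → X j n)) i

zShift : Series → Series
zShift X i zero    = + 0
zShift X i (suc n) = X i n

uShift-cong : ∀ {X Y : Series} → (∀ i n → X i n ≡ Y i n) → ∀ i n → uShift X i n ≡ uShift Y i n
uShift-cong X≡Y zero    n = refl
uShift-cong X≡Y (suc i) n = X≡Y i n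

zShift-cong : ∀ {X Y : Series} → (∀ i n → X i n ≡ Y i n) → ∀ i n → zShift X i n ≡ zShift Y i n
zShift-cong X≡Y i zero    = refl
zShift-cong X≡Y i (suc n) = X≡Y i n

⊛-congˡ : ∀ {F H : Series} (X : Series) → (∀ a b → F a b ≡ H a b) →
          ∀ i n → (F ⊛ X) i n ≡ (H ⊛ X) i n
⊛-congˡ X F≡H i n =
  sumTo-cong′ i (λ a → sumTo-cong′ n (λ b → cong (_* X (i ∸ a) (n ∸ b)) (F≡H a b)))

⊕-⊛ : ∀ F H X i n → ((F ⊕ H) ⊛ X) i n ≡ (F ⊛ X ⊕ H ⊛ X) i n
⊕-⊛ F H X i n =
  trans (sumTo-cong′ i (λ a →
          trans (sumTo-cong′ n (λ b → ℤP.*-distribʳ-+ (X (i ∸ a) (n ∸ b)) (F a b) (H a b)))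
                (sumTo-+ n _ _)))
        (sumTo-+ i _ _)

⊖-⊛ : ∀ F H X i n → ((F ⊖ H) ⊛ X) i n ≡ (F ⊛ X ⊖ H ⊛ X) i n
⊖-⊛ F H X i n =
  trans (sumTo-cong′ i (λ a →
          trans (sumTo-cong′ n (λ b → distrib (F a b) (H a b) (X (i ∸ a) (n ∸ b))))
                (sumTo-- n _ _)))
        (sumTo-- i _ _)
  where
  distrib : ∀ (f h x : ℤ) → (f - h) * x ≡ f * x - h * x
  distrib = solve-∀

oneS-⊛ : ∀ X i n → (oneS ⊛ X) i n ≡ X i n
oneS-⊛ X i n =
  trans (sumTo-single i 0 z≤n onlyConstant)
        (trans (sumTo-single n 0 z≤n (λ { zero 0≢0 → ⊥-elim (0≢0 refl) ; (suc b) _ → refl }))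
               (ℤP.*-identityˡ (X i n)))
  where
  onlyConstant : ∀ a → a ≢ 0 → sumTo n (λ b → oneS a b * X (i ∸ a) (n ∸ b)) ≡ + 0
  onlyConstant zero    0≢0 = ⊥-elim (0≢0 refl)
  onlyConstant (suc a) _   = sumTo-zero n (λ _ _ → refl)

uShift-⊛ : ∀ F X i n → (uShift F ⊛ X) i n ≡ uShift (F ⊛ X) i n
uShift-⊛ F X zero    n = sumTo-zero n (λ _ _ → refl)
uShift-⊛ F X (suc i) n =
  trans (sumTo-head i _)
        (trans (cong (_+ (F ⊛ X) i n) (sumTo-zero n (λ _ _ → refl)))
               (ℤP.+-identityˡ _))

zShift-⊛ : ∀ F X i n → (zShift F ⊛ X) i n ≡ zShift (F ⊛ X) i n
zShift-⊛ F X i zero    = sumTo-zero i (λ _ _ → refl)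
zShift-⊛ F X i (suc n) =
  sumTo-cong′ i (λ a → trans (sumTo-head n _) (ℤP.+-identityˡ _))

U-⊛ : ∀ X i n → (U ⊛ X) i n ≡ uShift X i n
U-⊛ X i n =
  trans (⊛-congˡ X U≡uShift1 i n)
        (trans (uShift-⊛ oneS X i n) (uShift-cong (oneS-⊛ X) i n))
  where
  U≡uShift1 : ∀ a b → U a b ≡ uShift oneS a b
  U≡uShift1 zero          b       = refl
  U≡uShift1 (suc zero)    zero    = refl
  U≡uShift1 (suc zero)    (suc b) = refl
  U≡uShift1 (suc (suc a)) b       = refl

Z-⊛ : ∀ X i n → (Z ⊛ X) i n ≡ zShift X i n
Z-⊛ X i n =
  trans (⊛-congˡ X Z≡zShift1 i n)
        (trans (zShift-⊛ oneS X i n) (zShift-cong (oneS-⊛ X) i n))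
  where
  Z≡zShift1 : ∀ a b → Z a b ≡ zShift oneS a b
  Z≡zShift1 zero    zero          = refl
  Z≡zShift1 (suc a) zero          = refl
  Z≡zShift1 zero    (suc zero)    = refl
  Z≡zShift1 (suc a) (suc zero)    = refl
  Z≡zShift1 zero    (suc (suc b)) = refl
  Z≡zShift1 (suc a) (suc (suc b)) = refl

W : Series
W = U ⊛ (oneS ⊕ Z ⊖ U ⊛ Z)

timesW : Series → Series
timesW X = uShift X ⊕ uShift (zShift X) ⊖ uShift (uShift (zShift X))

timesW-cong : ∀ {X Y : Series} → (∀ i n → X i n ≡ Y i n) → ∀ i n → timesW X i n ≡ timesW Y i n
timesW-cong X≡Y i n =
  cong₂ _-_ (cong₂ _+_ (uShift-cong X≡Y i n) (uShift-cong (zShift-cong X≡Y) i n))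
            (uShift-cong (uShift-cong (zShift-cong X≡Y)) i n)

W-⊛ : ∀ X i n → (W ⊛ X) i n ≡ timesW X i n
W-⊛ X i n = begin
  (W ⊛ X) i n
    ≡⟨ ⊛-congˡ X W-coefficients i n ⟩
  ((uShift oneS ⊕ uShift Z ⊖ uShift (uShift Z)) ⊛ X) i n
    ≡⟨ ⊖-⊛ (uShift oneS ⊕ uShift Z) (uShift (uShift Z)) X i n ⟩
  ((uShift oneS ⊕ uShift Z) ⊛ X) i n - (uShift (uShift Z) ⊛ X) i n
    ≡⟨ cong₂ _-_ (⊕-⊛ (uShift oneS) (uShift Z) X i n) (uShift-⊛ (uShift Z) X i n) ⟩
  (uShift oneS ⊛ X) i n + (uShift Z ⊛ X) i n - uShift (uShift Z ⊛ X) i n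
    ≡⟨ cong₂ _-_ (cong₂ _+_ (uShift-⊛ oneS X i n) (uShift-⊛ Z X i n))
                 (uShift-cong (uShift-⊛ Z X) i n) ⟩
  uShift (oneS ⊛ X) i n + uShift (Z ⊛ X) i n - uShift (uShift (Z ⊛ X)) i n
    ≡⟨ cong₂ _-_ (cong₂ _+_ (uShift-cong (oneS-⊛ X) i n) (uShift-cong (Z-⊛ X) i n))
                 (uShift-cong (uShift-cong (Z-⊛ X)) i n) ⟩
  timesW X i n ∎
  where
  open ≡-Reasoning
  W-coefficients : ∀ a b → W a b ≡ (uShift oneS ⊕ uShift Z ⊖ uShift (uShift Z)) a b
  W-coefficients a b = trans (U-⊛ (oneS ⊕ Z ⊖ U ⊛ Z) a b) (shifted a)
    where
    shifted : ∀ a → uShift (oneS ⊕ Z ⊖ U ⊛ Z) a b ≡ (uShift oneS ⊕ uShift Z ⊖ uShift (uShift Z)) a b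
    shifted zero    = refl
    shifted (suc a) = cong (λ x → oneS a b + Z a b - x) (U-⊛ Z a b)

-- Powers of W.  Since Wᵗ = uᵗ (1 + z(1 - u))ᵗ = Σₘ C(t,m) uᵗ (1 - u)ᵐ zᵐ,
-- the coefficient of uᶜ zᵐ in Wᵗ is C(t,m) · [uᶜ] uᵗ(1 - u)ᵐ.

Wpow : ℕ → Series
Wpow t c m = + (t C m) * (u^ t · [1-u]^ m) c

Wpow-below : ∀ t c m → c < t → Wpow t c m ≡ + 0
Wpow-below t c m c<t = trans (cong (+ (t C m) *_) (u^-below t ([1-u]^ m) c<t)) (ℤP.*-zeroʳ (+ (t C m)))

u^[1-u]^-suc : ∀ t m c →
  (u^ t · [1-u]^ suc m) c ≡ (u^ t · [1-u]^ m) c - (u^ suc t · [1-u]^ m) c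
u^[1-u]^-suc t m c =
  trans (u^-- t ([1-u]^ m) (u^ 1 · [1-u]^ m) c)
        (cong ((u^ t · [1-u]^ m) c -_) (u^-comm t ([1-u]^ m) c))

u^1-u^ : ∀ t (g : Poly) j → (u^ 1 · (u^ t · g)) j ≡ (u^ suc t · g) j
u^1-u^ t g zero    = refl
u^1-u^ t g (suc j) = refl

-- the Pascal recurrence C(t+1,m+1) = C(t,m) + C(t,m+1) is exactly
-- multiplication by W: Wᵗ⁺¹ = W · Wᵗ
timesW-Wpow : ∀ t c m → timesW (Wpow t) c m ≡ Wpow (suc t) c m
timesW-Wpow t zero          m       = sym (ℤP.*-zeroʳ (+ (suc t C m)))
timesW-Wpow t (suc zero)    zero    = trans (ℤP.+-identityʳ _) (ℤP.+-identityʳ _)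
timesW-Wpow t (suc (suc c)) zero    = trans (ℤP.+-identityʳ _) (ℤP.+-identityʳ _)
timesW-Wpow t (suc c)       (suc m) = begin
  + A * x + + B * y - (u^ 1 · (λ j → + B * g j)) c
    ≡⟨ cong (λ v → + A * x + + B * y - v)
            (trans (u^-scale 1 (+ B) g c) (cong (+ B *_) (u^1-u^ t ([1-u]^ m) c))) ⟩
  + A * x + + B * y - + B * s
    ≡⟨ cong (λ v → + A * v + + B * y - + B * s) (u^[1-u]^-suc t m c) ⟩
  + A * (y - s) + + B * y - + B * s
    ≡⟨ collect (+ A) (+ B) y s ⟩
  (+ B + + A) * (y - s)
    ≡⟨ cong₂ _*_ (trans (sym (ℤP.pos-+ B A)) (cong +_ (nCk+nC[k+1]≡[n+1]C[k+1] t m)))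
                 (sym (u^[1-u]^-suc t m c)) ⟩
  + (suc t C suc m) * x ∎
  where
  open ≡-Reasoning
  A B : ℕ
  A = t C suc m
  B = t C m
  g : Poly
  g = u^ t · [1-u]^ m
  x y s : ℤ
  x = (u^ t · [1-u]^ suc m) c
  y = g c
  s = (u^ suc t · [1-u]^ m) c
  collect : ∀ (a b y s : ℤ) → a * (y - s) + b * y - b * s ≡ (b + a) * (y - s)
  collect = solve-∀

pow-W : ∀ t c m → pow W t c m ≡ Wpow t c m
pow-W zero    zero    zero    = refl
pow-W zero    (suc c) zero    = refl
pow-W zero    zero    (suc m) = sym (ℤP.*-zeroˡ (([1-u]^ suc m) 0))
pow-W zero    (suc c) (suc m) = sym (ℤP.*-zeroˡ (([1-u]^ suc m) (suc c)))
pow-W (suc t) c       m       =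
  trans (W-⊛ (pow W t) c m)
        (trans (timesW-cong (pow-W t) c m) (timesW-Wpow t c m))

sumL : {A : Set} → List A → (A → ℤ) → ℤ
sumL []       f = + 0
sumL (x ∷ xs) f = f x + sumL xs f

sumL-cong : {A : Set} (xs : List A) {f g : A → ℤ} → (∀ x → f x ≡ g x) → sumL xs f ≡ sumL xs g
sumL-cong []       f≡g = refl
sumL-cong (x ∷ xs) f≡g = cong₂ _+_ (f≡g x) (sumL-cong xs f≡g)

sumL-congAll : {A : Set} {P : A → Set} {xs : List A} {f g : A → ℤ} →
               All P xs → (∀ {x} → P x → f x ≡ g x) → sumL xs f ≡ sumL xs g
sumL-congAll []         f≡g = refl
sumL-congAll (px ∷ pxs) f≡g = cong₂ _+_ (f≡g px) (sumL-congAll pxs f≡g)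

sumL-++ : {A : Set} (xs ys : List A) (f : A → ℤ) → sumL (xs ++ ys) f ≡ sumL xs f + sumL ys f
sumL-++ []       ys f = sym (ℤP.+-identityˡ (sumL ys f))
sumL-++ (x ∷ xs) ys f =
  trans (cong (λ v → f x + v) (sumL-++ xs ys f)) (sym (ℤP.+-assoc (f x) (sumL xs f) (sumL ys f)))

sumL-map : {A B : Set} (g : A → B) (xs : List A) (f : B → ℤ) →
           sumL (map g xs) f ≡ sumL xs (λ x → f (g x))
sumL-map g []       f = refl
sumL-map g (x ∷ xs) f = cong (λ v → f (g x) + v) (sumL-map g xs f)

sumL-concatMap : {A B : Set} (g : A → List B) (xs : List A) (f : B → ℤ) →
                 sumL (concatMap g xs) f ≡ sumL xs (λ x → sumL (g x) f)
sumL-concatMap g []       f = refl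
sumL-concatMap g (x ∷ xs) f =
  trans (sumL-++ (g x) (concatMap g xs) f) (cong (λ v → sumL (g x) f + v) (sumL-concatMap g xs f))

sumL-+ : {A : Set} (xs : List A) (f g : A → ℤ) → sumL xs (λ x → f x + g x) ≡ sumL xs f + sumL xs g
sumL-+ []       f g = refl
sumL-+ (x ∷ xs) f g =
  trans (cong (λ v → f x + g x + v) (sumL-+ xs f g)) (interchange (f x) (g x) (sumL xs f) (sumL xs g))
  where
  interchange : ∀ (a b c d : ℤ) → (a + b) + (c + d) ≡ (a + c) + (b + d)
  interchange = solve-∀

sumL-*ʳ : {A : Set} (xs : List A) (k : ℤ) (f : A → ℤ) → sumL xs (λ x → f x * k) ≡ sumL xs f * k
sumL-*ʳ []       k f = refl
sumL-*ʳ (x ∷ xs) k f =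
  trans (cong (λ v → f x * k + v) (sumL-*ʳ xs k f)) (sym (ℤP.*-distribʳ-+ k (f x) (sumL xs f)))

sumL-zero : {A : Set} (xs : List A) → sumL xs (λ _ → + 0) ≡ + 0
sumL-zero []       = refl
sumL-zero (x ∷ xs) = trans (ℤP.+-identityˡ _) (sumL-zero xs)

sumL-ones : {A : Set} (xs : List A) → sumL xs (λ _ → + 1) ≡ + length xs
sumL-ones []       = refl
sumL-ones (x ∷ xs) = cong (λ v → + 1 + v) (sumL-ones xs)

sumTo-sumL : {A : Set} (N : ℕ) (xs : List A) (g : ℕ → A → ℤ) →
             sumTo N (λ a → sumL xs (g a)) ≡ sumL xs (λ x → sumTo N (λ a → g a x))
sumTo-sumL N []       g = sumTo-zero N (λ _ _ → refl)
sumTo-sumL N (x ∷ xs) g =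
  trans (sumTo-+ N (λ a → g a x) (λ a → sumL xs (g a)))
        (cong (λ v → sumTo N (λ a → g a x) + v) (sumTo-sumL N xs g))

sumL-upTo-suc : ∀ t (f : ℕ → ℤ) → sumL (upTo (suc t)) f ≡ sumL (upTo t) f + f t
sumL-upTo-suc t f =
  trans (cong (λ xs → sumL xs f) (sym (ℒP.upTo-∷ʳ t)))
        (trans (sumL-++ (upTo t) [ t ] f) (cong (λ v → sumL (upTo t) f + v) (ℤP.+-identityʳ (f t))))

sumL-binomial : ∀ t m → sumL (upTo t) (λ r → + (r C m)) ≡ + (t C suc m)
sumL-binomial zero    m = refl
sumL-binomial (suc t) m =
  trans (sumL-upTo-suc t _)
        (trans (cong (_+ + (t C m)) (sumL-binomial t m))
               (trans (sym (ℤP.pos-+ (t C suc m) (t C m)))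
                      (cong +_ (trans (ℕP.+-comm (t C suc m) (t C m)) (nCk+nC[k+1]≡[n+1]C[k+1] t m)))))

<ᵇ-true : ∀ {m n} → m < n → (m <ᵇ n) ≡ true
<ᵇ-true {zero}  {suc n} _         = refl
<ᵇ-true {suc m} {suc n} (s≤s m<n) = <ᵇ-true m<n

<ᵇ-false : ∀ {m n} → n ≤ m → (m <ᵇ n) ≡ false
<ᵇ-false {m}     {zero}  _         = refl
<ᵇ-false {suc m} {suc n} (s≤s n≤m) = <ᵇ-false n≤m

sumL-upTo-split : ∀ {p t} (f g : ℕ → ℤ) → p ≤ t →
  sumL (upTo t) (λ r → if r <ᵇ p then f r else g r)
    ≡ sumL (upTo p) f + (sumL (upTo t) g - sumL (upTo p) g)
sumL-upTo-split {p} {t} f g p≤t with ℕP.m≤n⇒m<n∨m≡n p≤t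
... | inj₂ refl =
  trans (sumL-congAll (AllP.all-upTo p) (λ {r} r<p → cong (λ b → if b then f r else g r) (<ᵇ-true r<p)))
        (sym (trans (cong (λ v → sumL (upTo p) f + v) (ℤP.+-inverseʳ (sumL (upTo p) g)))
                    (ℤP.+-identityʳ (sumL (upTo p) f))))
sumL-upTo-split {p} {suc t} f g _ | inj₁ (s≤s p≤t) = begin
  sumL (upTo (suc t)) h
    ≡⟨ sumL-upTo-suc t h ⟩
  sumL (upTo t) h + h t
    ≡⟨ cong₂ _+_ (sumL-upTo-split f g p≤t) (cong (λ b → if b then f t else g t) (<ᵇ-false p≤t)) ⟩
  F + (G - Gp) + g t
    ≡⟨ regroup F G Gp (g t) ⟩
  F + ((G + g t) - Gp)
    ≡⟨ cong (λ x → F + (x - Gp)) (sym (sumL-upTo-suc t g)) ⟩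
  F + (sumL (upTo (suc t)) g - Gp) ∎
  where
  open ≡-Reasoning
  h : ℕ → ℤ
  h r = if r <ᵇ p then f r else g r
  F G Gp : ℤ
  F = sumL (upTo p) f
  G = sumL (upTo t) g
  Gp = sumL (upTo p) g
  regroup : ∀ (a b c d : ℤ) → a + (b - c) + d ≡ a + ((b + d) - c)
  regroup = solve-∀

Node : Set
Node = ℕ × ℕ

root : Node
root = (1 , 0)

child : Node → ℕ → Node
child (t , p) r = if r <ᵇ p then (t , r) else (suc t , r)

children : Node → List Node
children (t , p) = map (child (t , p)) (upTo t)

level : ℕ → List Node
level zero    = [ root ]
level (suc ℓ) = concatMap children (level ℓ)

WellFormed : ℕ → Node → Set
WellFormed ℓ (t , p) = p < t × t ≤ suc ℓ

level-wellFormed : ∀ ℓ → All (WellFormed ℓ) (level ℓ)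
level-wellFormed zero    = (s≤s z≤n , s≤s z≤n) ∷ []
level-wellFormed (suc ℓ) =
  AllP.concat⁺ (AllP.map⁺ (All.map children-wellFormed (level-wellFormed ℓ)))
  where
  child-wellFormed : ∀ {t p} → t ≤ suc ℓ → ∀ {r} → r < t → WellFormed (suc ℓ) (child (t , p) r)
  child-wellFormed {t} {p} t≤ {r} r<t with r <ᵇ p
  ... | true  = r<t , ℕP.m≤n⇒m≤1+n t≤
  ... | false = ℕP.m≤n⇒m≤1+n r<t , s≤s t≤
  children-wellFormed : ∀ {ν} → WellFormed ℓ ν → All (WellFormed (suc ℓ)) (children ν)
  children-wellFormed {t , p} (_ , t≤) =
    AllP.map⁺ (All.map (child-wellFormed {p = p} t≤) (AllP.all-upTo t))

treeGF : Series
treeGF i n = sumL (level n) (λ ν → (u^ proj₁ ν · 1ₚ) i)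

sift : ∀ N t (F : ℕ → ℤ) → (∀ a → N < a → F a ≡ + 0) →
       sumTo N (λ a → (u^ t · 1ₚ) a * F a) ≡ F t
sift N t F vanish with ℕP.≤-<-connex t N
... | inj₁ t≤N =
  trans (sumTo-single N t t≤N (λ j j≢t → cong (_* F j) (u^-off t j≢t)))
        (trans (cong (_* F t) (u^-at t 1ₚ)) (ℤP.*-identityˡ (F t)))
... | inj₂ N<t =
  trans (sumTo-zero N (λ j j≤N → cong (_* F j) (u^-off t (ℕP.<⇒≢ (ℕP.≤-<-trans j≤N N<t)))))
        (sym (vanish t N<t))

sift-nodes : ∀ N (xs : List Node) (F : ℕ → ℤ) → (∀ a → N < a → F a ≡ + 0) →
  sumTo N (λ a → sumL xs (λ ν → (u^ proj₁ ν · 1ₚ) a) * F a) ≡ sumL xs (λ ν → F (proj₁ ν))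
sift-nodes N xs F vanish =
  trans (sumTo-cong′ N (λ a → sym (sumL-*ʳ xs (F a) (λ ν → (u^ proj₁ ν · 1ₚ) a))))
        (trans (sumTo-sumL N xs (λ a ν → (u^ proj₁ ν · 1ₚ) a * F a))
               (sumL-cong xs (λ ν → sift N (proj₁ ν) F vanish)))

-- With φₘ(t , p) = C(p,m) · uᵗ(1 - u)^{m+1}, the hockey-stick identity
-- gives for every node  Σ_{children} φₘ = φₘ₊₁ + u·[zᵐ⁺¹]Wᵗ,  and
-- φ₀(t , p) + u·[z⁰]Wᵗ = uᵗ.  Pushing φ down the tree telescopes
-- [zⁿ]T into the root term plus [zⁿ] u·T(W, z).

-- the root weight φₙ(1 , 0) = C(0,n) · u(1 - u)^{n+1} is u(1 - u) for n = 0
-- and 0 afterwards; read at u^{c+1}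
root-coefficient : ∀ c n → + (0 C n) * ([1-u]^ suc n) c ≡ oneS c n - U c n
root-coefficient zero          zero    = refl
root-coefficient (suc zero)    zero    = refl
root-coefficient (suc (suc c)) zero    = refl
root-coefficient zero          (suc n) = refl
root-coefficient (suc zero)    (suc n) = refl
root-coefficient (suc (suc c)) (suc n) = refl

module Kernel (c : ℕ) where

  φ : ℕ → Node → ℤ
  φ m (t , p) = + (p C m) * (u^ t · [1-u]^ suc m) (suc c)

  Q : ℕ → ℕ → ℤ
  Q b m = sumL (level b) (λ ν → Wpow (proj₁ ν) c m)

  φ-child : ∀ m t p r → φ m (child (t , p) r)
    ≡ (if r <ᵇ p then + (r C m) * (u^ t · [1-u]^ suc m) (suc c)
                 else + (r C m) * (u^ t · [1-u]^ suc m) c)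
  φ-child m t p r with r <ᵇ p
  ... | true  = refl
  ... | false = refl

  -- Σ_{children} φₘ = φₘ₊₁ + u·[zᵐ⁺¹]Wᵗ: split at p, then the hockey stick
  φ-children : ∀ m t p → p ≤ t → sumL (children (t , p)) (φ m) ≡ φ (suc m) (t , p) + Wpow t c (suc m)
  φ-children m t p p≤t = begin
    sumL (children (t , p)) (φ m)
      ≡⟨ trans (sumL-map (child (t , p)) (upTo t) (φ m)) (sumL-cong (upTo t) (φ-child m t p)) ⟩
    sumL (upTo t) (λ r → if r <ᵇ p then + (r C m) * S₁ else + (r C m) * S₂)
      ≡⟨ sumL-upTo-split (λ r → + (r C m) * S₁) (λ r → + (r C m) * S₂) p≤t ⟩
    sumL (upTo p) (λ r → + (r C m) * S₁)
      + (sumL (upTo t) (λ r → + (r C m) * S₂) - sumL (upTo p) (λ r → + (r C m) * S₂))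
      ≡⟨ cong₂ (λ a b → a + (b - sumL (upTo p) (λ r → + (r C m) * S₂)))
               (binomial-times p S₁) (binomial-times t S₂) ⟩
    + (p C suc m) * S₁ + (+ (t C suc m) * S₂ - sumL (upTo p) (λ r → + (r C m) * S₂))
      ≡⟨ cong (λ a → + (p C suc m) * S₁ + (+ (t C suc m) * S₂ - a)) (binomial-times p S₂) ⟩
    + (p C suc m) * S₁ + (+ (t C suc m) * S₂ - + (p C suc m) * S₂)
      ≡⟨ regroup (+ (p C suc m)) (+ (t C suc m)) S₁ S₂ ⟩
    + (p C suc m) * (S₁ - S₂) + + (t C suc m) * S₂
      ≡⟨ cong (λ a → + (p C suc m) * a + + (t C suc m) * S₂) (sym (u^[1-u]^-suc t (suc m) (suc c))) ⟩
    φ (suc m) (t , p) + Wpow t c (suc m) ∎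
    where
    open ≡-Reasoning
    S₁ S₂ : ℤ
    S₁ = (u^ t · [1-u]^ suc m) (suc c)
    S₂ = (u^ t · [1-u]^ suc m) c
    binomial-times : ∀ q S → sumL (upTo q) (λ r → + (r C m) * S) ≡ + (q C suc m) * S
    binomial-times q S = trans (sumL-*ʳ (upTo q) S (λ r → + (r C m))) (cong (_* S) (sumL-binomial q m))
    regroup : ∀ (a b x y : ℤ) → a * x + (b * y - a * y) ≡ a * (x - y) + b * y
    regroup = solve-∀

  φ-level : ∀ b m → sumL (level (suc b)) (φ m)
                    ≡ sumL (level b) (λ ν → φ (suc m) ν + Wpow (proj₁ ν) c (suc m))
  φ-level b m =
    trans (sumL-concatMap children (level b) (φ m))
          (sumL-congAll (level-wellFormed b)
                        (λ { {t , p} (p<t , _) → φ-children m t p (ℕP.<⇒≤ p<t) }))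

  telescope : ∀ b m → sumL (level b) (λ ν → φ m ν + Wpow (proj₁ ν) c m)
                      ≡ φ (m ℕ.+ b) root + sumTo b (λ k → Q k (m ℕ.+ b ∸ k))
  telescope zero m rewrite ℕP.+-identityʳ m =
    ℤP.+-assoc (φ m root) (Wpow 1 c m) (+ 0)
  telescope (suc b) m rewrite ℕP.+-suc m b = begin
    sumL (level (suc b)) (λ ν → φ m ν + Wpow (proj₁ ν) c m)
      ≡⟨ sumL-+ (level (suc b)) (φ m) (λ ν → Wpow (proj₁ ν) c m) ⟩
    sumL (level (suc b)) (φ m) + Q (suc b) m
      ≡⟨ cong (_+ Q (suc b) m) (trans (φ-level b m) (telescope b (suc m))) ⟩
    φ (suc m ℕ.+ b) root + sumTo b (λ k → Q k (suc m ℕ.+ b ∸ k)) + Q (suc b) m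
      ≡⟨ ℤP.+-assoc (φ (suc m ℕ.+ b) root) (sumTo b (λ k → Q k (suc m ℕ.+ b ∸ k))) (Q (suc b) m) ⟩
    φ (suc m ℕ.+ b) root + (sumTo b (λ k → Q k (suc m ℕ.+ b ∸ k)) + Q (suc b) m)
      ≡⟨ cong (λ j → φ (suc m ℕ.+ b) root + (sumTo b (λ k → Q k (suc m ℕ.+ b ∸ k)) + Q (suc b) j))
              (sym (ℕP.m+n∸n≡m m b)) ⟩
    φ (suc (m ℕ.+ b)) root + sumTo (suc b) (λ k → Q k (suc (m ℕ.+ b) ∸ k)) ∎
    where open ≡-Reasoning

  monomial-split : ∀ t p → (u^ t · 1ₚ) (suc c) ≡ φ 0 (t , p) + Wpow t c 0
  monomial-split t p =
    trans (split ((u^ t · 1ₚ) (suc c)) ((u^ t · 1ₚ) c))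
          (cong (λ a → + 1 * a + + 1 * (u^ t · 1ₚ) c) (sym (u^[1-u]^-suc t 0 (suc c))))
    where
    split : ∀ (x y : ℤ) → x ≡ + 1 * (x - y) + + 1 * y
    split = solve-∀

  tree-suc : ∀ n → treeGF (suc c) n ≡ (oneS c n - U c n) + sumTo n (λ b → Q b (n ∸ b))
  tree-suc n =
    trans (sumL-cong (level n) (λ { (t , p) → monomial-split t p }))
          (trans (telescope n 0) (cong (_+ sumTo n (λ b → Q b (n ∸ b))) (root-coefficient c n)))

  substU-tree : ∀ n → substU treeGF W c n ≡ sumTo n (λ b → Q b (n ∸ b))
  substU-tree n =
    trans (sumTo-cong′ c (λ a → sumTo-cong′ n (λ b → cong (treeGF a b *_) (pow-W a c (n ∸ b)))))
          (trans (sumTo-swap c n (λ a b → treeGF a b * Wpow a c (n ∸ b)))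
                 (sumTo-cong′ n (λ b → sift-nodes c (level b) (λ a → Wpow a c (n ∸ b))
                                                   (λ a c<a → Wpow-below a c (n ∸ b) c<a))))

RHS : Series → Series
RHS G = U ⊛ (oneS ⊖ U) ⊕ U ⊛ substU G W

RHS-zero : ∀ G n → RHS G 0 n ≡ + 0
RHS-zero G n = cong₂ _+_ (U-⊛ (oneS ⊖ U) 0 n) (U-⊛ (substU G W) 0 n)

RHS-suc : ∀ G c n → RHS G (suc c) n ≡ (oneS c n - U c n) + substU G W c n
RHS-suc G c n = cong₂ _+_ (U-⊛ (oneS ⊖ U) (suc c) n) (U-⊛ (substU G W) (suc c) n)

RHS-local : ∀ G H c n → (∀ a → a ≤ c → ∀ b → G a b ≡ H a b) → RHS G (suc c) n ≡ RHS H (suc c) n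
RHS-local G H c n G≡H =
  trans (RHS-suc G c n)
        (trans (cong (λ v → oneS c n - U c n + v)
                     (sumTo-cong c (λ a a≤c → sumTo-cong′ n (λ b → cong (_* pow W a c (n ∸ b)) (G≡H a a≤c b)))))
               (sym (RHS-suc H c n)))

-- all labels are ≥ 1, so T has no u⁰ terms
tree-zero : ∀ n → treeGF 0 n ≡ + 0
tree-zero n =
  trans (sumL-congAll (level-wellFormed n) (λ { {t , p} (p<t , _) → u^-off t (ℕP.<⇒≢ (ℕP.≤-<-trans z≤n p<t)) }))
        (sumL-zero (level n))

tree-isG : IsG treeGF
tree-isG zero    n = trans (tree-zero n) (sym (RHS-zero treeGF n))
tree-isG (suc c) n =
  trans (Kernel.tree-suc c n)
        (sym (trans (RHS-suc treeGF c n) (cong (λ v → oneS c n - U c n + v) (Kernel.substU-tree c n))))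

-- the functional equation determines the coefficients of u⁰, u¹, … in turn
isG-unique : ∀ G H → IsG G → IsG H → ∀ i n → G i n ≡ H i n
isG-unique G H isG isH = <-rec (λ i → ∀ n → G i n ≡ H i n) step
  where
  step : ∀ i → (∀ {a} → a < i → ∀ b → G a b ≡ H a b) → ∀ n → G i n ≡ H i n
  step zero    _  n = trans (isG 0 n) (trans (RHS-zero G n) (sym (trans (isH 0 n) (RHS-zero H n))))
  step (suc c) ih n =
    trans (isG (suc c) n) (trans (RHS-local G H c n (λ a a≤c → ih (s≤s a≤c))) (sym (isH (suc c) n)))

-- nodes at level n have label ≤ n + 1
tree-support : ∀ n i → suc n < i → treeGF i n ≡ + 0
tree-support n i n+1<i =
  trans (sumL-congAll (level-wellFormed n)
          (λ { {t , p} (_ , t≤n+1) → u^-off t (ℕP.>⇒≢ (ℕP.≤-<-trans t≤n+1 n+1<i)) }))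
        (sumL-zero (level n))

tree-total : ∀ n → sumTo (suc n) (λ i → treeGF i n) ≡ + length (level n)
tree-total n =
  trans (sumTo-sumL (suc n) (level n) (λ i ν → (u^ proj₁ ν · 1ₚ) i))
        (trans (sumL-congAll (level-wellFormed n) (λ { {t , p} (_ , t≤n+1) → monomial-total t≤n+1 }))
               (sumL-ones (level n)))
  where
  monomial-total : ∀ {t N} → t ≤ N → sumTo N (u^ t · 1ₚ) ≡ + 1
  monomial-total {t} {N} t≤N = trans (sumTo-single N t t≤N (λ j → u^-off t)) (u^-at t 1ₚ)

count< : (ℕ → Bool) → ℕ → ℕ
count< q zero    = 0
count< q (suc N) = if q N then suc (count< q N) else count< q N

count<-cong : ∀ N {q q′ : ℕ → Bool} → (∀ y → y < N → q y ≡ q′ y) → count< q N ≡ count< q′ N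
count<-cong zero    _    = refl
count<-cong (suc N) q≡q′
  rewrite q≡q′ N ℕP.≤-refl | count<-cong N (λ y y<N → q≡q′ y (ℕP.m≤n⇒m≤1+n y<N)) = refl

count<-step : ∀ q N → count< q N ≤ count< q (suc N)
count<-step q N with q N
... | true  = ℕP.n≤1+n (count< q N)
... | false = ℕP.≤-refl

count<-mono : ∀ q {a b} → a ≤ b → count< q a ≤ count< q b
count<-mono q {b = zero}  z≤n  = ℕP.≤-refl
count<-mono q {b = suc b} a≤1+b with ℕP.m≤n⇒m<n∨m≡n a≤1+b
... | inj₁ (s≤s a≤b) = ℕP.≤-trans (count<-mono q a≤b) (count<-step q b)
... | inj₂ refl      = ℕP.≤-refl

count<-strict : ∀ q {a b} → q a ≡ true → a < b → count< q a < count< q b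
count<-strict q {a} qa a<b = ℕP.<-≤-trans passing (count<-mono q a<b)
  where
  passing : count< q a < count< q (suc a)
  passing rewrite qa = ℕP.≤-refl

count<-remove : ∀ N {q q′ : ℕ → Bool} a → a < N → q a ≡ true → q′ a ≡ false →
                (∀ y → y ≢ a → q′ y ≡ q y) → suc (count< q′ N) ≡ count< q N
count<-remove (suc N) {q} {q′} a a<1+N qa q′a q′≡q with ℕP.m≤n⇒m<n∨m≡n (ℕP.≤-pred a<1+N)
... | inj₂ refl rewrite qa | q′a = cong suc (count<-cong a (λ y y<a → q′≡q y (ℕP.<⇒≢ y<a)))
... | inj₁ a<N rewrite q′≡q N (ℕP.>⇒≢ a<N) with q N
...   | true  = cong suc (count<-remove N a a<N qa q′a q′≡q)
...   | false = count<-remove N a a<N qa q′a q′≡q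

rank : {B : Set} (q : ℕ → Bool) (N : ℕ) (G : ℕ → B) →
       map (λ x → G (count< q x)) (filterᵇ q (upTo N)) ≡ map G (upTo (count< q N))
rank q zero    G = refl
rank {B} q (suc N) G = begin
  map G′ (filterᵇ q (upTo (suc N)))
    ≡⟨ cong (λ xs → map G′ (filterᵇ q xs)) (sym (ℒP.upTo-∷ʳ N)) ⟩
  map G′ (filterᵇ q (upTo N ++ [ N ]))
    ≡⟨ cong (map G′) (ℒP.filter-++ (T? ∘ q) (upTo N) [ N ]) ⟩
  map G′ (filterᵇ q (upTo N) ++ filterᵇ q [ N ])
    ≡⟨ ℒP.map-++ G′ (filterᵇ q (upTo N)) (filterᵇ q [ N ]) ⟩
  map G′ (filterᵇ q (upTo N)) ++ map G′ (filterᵇ q [ N ])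
    ≡⟨ cong (_++ map G′ (filterᵇ q [ N ])) (rank q N G) ⟩
  map G (upTo (count< q N)) ++ map G′ (filterᵇ q [ N ])
    ≡⟨ last-value ⟩
  map G (upTo (count< q (suc N))) ∎
  where
  open ≡-Reasoning
  G′ : ℕ → B
  G′ x = G (count< q x)
  last-value : map G (upTo (count< q N)) ++ map G′ (filterᵇ q [ N ]) ≡ map G (upTo (count< q (suc N)))
  last-value with q N
  ... | true  = trans (sym (ℒP.map-++ G (upTo (count< q N)) [ count< q N ]))
                      (cong (map G) (ℒP.upTo-∷ʳ (count< q N)))
  ... | false = ℒP.++-identityʳ (map G (upTo (count< q N)))

-- Vincular patterns 1̲0̲τ: an adjacent descent e_i > e_{i+1} followed later
-- by the value τ(e_i, e_{i+1}).  τ x y = y gives 1̲0̲0, τ x y = x gives 1̲0̲1.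

-- the last entry of a sequence
lastEntry : List ℕ → ℕ
lastEntry []          = 0
lastEntry (a ∷ [])    = a
lastEntry (a ∷ b ∷ r) = lastEntry (b ∷ r)

lastEntry-snoc : ∀ e x → lastEntry (e ++ [ x ]) ≡ x
lastEntry-snoc []          x = refl
lastEntry-snoc (a ∷ [])    x = refl
lastEntry-snoc (a ∷ b ∷ r) x = lastEntry-snoc (b ∷ r) x

any-snoc : (p : ℕ → Bool) (xs : List ℕ) (z : ℕ) → any p (xs ++ [ z ]) ≡ (any p xs ∨ p z)
any-snoc p []       z = 𝔹P.∨-identityʳ (p z)
any-snoc p (x ∷ xs) z = trans (cong (p x ∨_) (any-snoc p xs z)) (sym (𝔹P.∨-assoc (p x) (any p xs) (p z)))

≡ᵇ-refl : ∀ a → (a ≡ᵇ a) ≡ true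
≡ᵇ-refl zero    = refl
≡ᵇ-refl (suc a) = ≡ᵇ-refl a

≡ᵇ-≢ : ∀ {a b} → a ≢ b → (a ≡ᵇ b) ≡ false
≡ᵇ-≢ {zero}  {zero}  a≢b = ⊥-elim (a≢b refl)
≡ᵇ-≢ {zero}  {suc b} _   = refl
≡ᵇ-≢ {suc a} {zero}  _   = refl
≡ᵇ-≢ {suc a} {suc b} a≢b = ≡ᵇ-≢ (λ a≡b → a≢b (cong suc a≡b))

module Descent (τ : ℕ → ℕ → ℕ) where
  open ∨-∧-Solver using (solve; _:+_; _:*_; _:=_)

  occurs : List ℕ → Bool
  occurs (x ∷ y ∷ rest) = ((y <ᵇ x) ∧ any (λ w → w ≡ᵇ τ x y) rest) ∨ occurs (y ∷ rest)
  occurs _              = false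

  completes : List ℕ → ℕ → Bool
  completes (x ∷ y ∷ rest) z = ((y <ᵇ x) ∧ (z ≡ᵇ τ x y)) ∨ completes (y ∷ rest) z
  completes _              z = false

  occurs-snoc : ∀ e z → occurs (e ++ [ z ]) ≡ (occurs e ∨ completes e z)
  occurs-snoc []          z = refl
  occurs-snoc (a ∷ [])    z = trans (𝔹P.∨-identityʳ _) (𝔹P.∧-zeroʳ (z <ᵇ a))
  occurs-snoc (a ∷ b ∷ r) z =
    trans (cong₂ (λ u v → ((b <ᵇ a) ∧ u) ∨ v) (any-snoc (λ w → w ≡ᵇ τ a b) r z) (occurs-snoc (b ∷ r) z))
          (regroup (b <ᵇ a) (any (λ w → w ≡ᵇ τ a b) r) (z ≡ᵇ τ a b) (occurs (b ∷ r)) (completes (b ∷ r) z))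
    where
    regroup : ∀ d p q o c → ((d ∧ (p ∨ q)) ∨ (o ∨ c)) ≡ (((d ∧ p) ∨ o) ∨ ((d ∧ q) ∨ c))
    regroup = solve 5 (λ d p q o c → (d :* (p :+ q)) :+ (o :+ c) := ((d :* p) :+ o) :+ ((d :* q) :+ c)) refl

  completes-snoc : ∀ e x z →
    completes (e ++ [ x ]) z ≡ (completes e z ∨ ((x <ᵇ lastEntry e) ∧ (z ≡ᵇ τ (lastEntry e) x)))
  completes-snoc []          x z = refl
  completes-snoc (a ∷ [])    x z = 𝔹P.∨-identityʳ _
  completes-snoc (a ∷ b ∷ r) x z =
    trans (cong (((b <ᵇ a) ∧ (z ≡ᵇ τ a b)) ∨_) (completes-snoc (b ∷ r) x z))
          (sym (𝔹P.∨-assoc ((b <ᵇ a) ∧ (z ≡ᵇ τ a b)) (completes (b ∷ r) z) _))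

filterᵇ-cong : {A : Set} {p q : A → Bool} → (∀ x → p x ≡ q x) → ∀ xs → filterᵇ p xs ≡ filterᵇ q xs
filterᵇ-cong {p = p} {q} p≡q =
  ℒP.filter-≐ (T? ∘ p) (T? ∘ q) ((λ {x} → subst T (p≡q x)) , (λ {x} → subst T (sym (p≡q x))))

filterᵇ-none : {A : Set} (q : A → Bool) (xs : List A) → (∀ x → q x ≡ false) → filterᵇ q xs ≡ []
filterᵇ-none q []       _      = refl
filterᵇ-none q (x ∷ xs) q≡false rewrite q≡false x = filterᵇ-none q xs q≡false

filterᵇ-map : {A B : Set} (q : B → Bool) (f : A → B) (xs : List A) →
              filterᵇ q (map f xs) ≡ map f (filterᵇ (q ∘ f) xs)
filterᵇ-map q f []       = refl
filterᵇ-map q f (x ∷ xs) with q (f x)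
... | true  = cong (f x ∷_) (filterᵇ-map q f xs)
... | false = filterᵇ-map q f xs

filterᵇ-concatMap : {A B : Set} (q : B → Bool) (f : A → List B) (xs : List A) →
                    filterᵇ q (concatMap f xs) ≡ concatMap (filterᵇ q ∘ f) xs
filterᵇ-concatMap q f []       = refl
filterᵇ-concatMap q f (x ∷ xs) =
  trans (ℒP.filter-++ (T? ∘ q) (f x) (concatMap f xs))
        (cong (filterᵇ q (f x) ++_) (filterᵇ-concatMap q f xs))

filterᵇ-All : {A : Set} {R : A → Set} (q : A → Bool) {xs : List A} →
              All R xs → All (λ x → q x ≡ true × R x) (filterᵇ q xs)
filterᵇ-All q []                   = []
filterᵇ-All q {x ∷ xs} (rx ∷ rxs) with q x in qx
... | true  = (qx , rx) ∷ filterᵇ-All q rxs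
... | false = filterᵇ-All q rxs

map-congAll : {A B : Set} {R : A → Set} {f g : A → B} {xs : List A} →
              All R xs → (∀ {x} → R x → f x ≡ g x) → map f xs ≡ map g xs
map-congAll []         f≡g = refl
map-congAll (rx ∷ rxs) f≡g = cong₂ _∷_ (f≡g rx) (map-congAll rxs f≡g)

Bounded : ℕ → List ℕ → Set
Bounded n e = length e ≡ n × All (_< n) e

length-snoc : ∀ (e : List ℕ) x → length (e ++ [ x ]) ≡ suc (length e)
length-snoc e x = trans (ℒP.length-++ e) (ℕP.+-comm (length e) 1)

invSeqs-bounded : ∀ n → All (Bounded n) (invSeqs n)
invSeqs-bounded zero    = (refl , []) ∷ []
invSeqs-bounded (suc n) =
  AllP.concat⁺ (AllP.map⁺ (All.map extensions-bounded (invSeqs-bounded n)))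
  where
  extensions-bounded : ∀ {e} → Bounded n e → All (Bounded (suc n)) (map (λ x → e ++ [ x ]) (upTo (suc n)))
  extensions-bounded {e} (len , e<n) =
    AllP.map⁺ (All.map (λ {x} x<1+n → trans (length-snoc e x) (cong suc len)
                                    , AllP.++⁺ (All.map ℕP.m≤n⇒m≤1+n e<n) (x<1+n ∷ []))
                       (AllP.all-upTo (suc n)))

lastEntry-bound : ∀ {n} e → All (_< n) e → lastEntry e < suc n
lastEntry-bound []          _             = s≤s z≤n
lastEntry-bound (a ∷ [])    (a<n ∷ [])    = ℕP.m≤n⇒m≤1+n a<n
lastEntry-bound (a ∷ b ∷ r) (_ ∷ b∷r<n) = lastEntry-bound (b ∷ r) b∷r<n

-- Appending the r-th allowed
-- value x produces the label child (t , p) r: a descent (x below the last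
-- entry, r < p) forbids exactly one further allowed value τ(last, x) ≥ x,
-- while the new value n + 1 becomes allowed; an ascent forbids nothing.

child-below : ∀ {t p r} → r < p → child (t , p) r ≡ (t , r)
child-below {t} {p} {r} r<p = cong (λ b → if b then (t , r) else (suc t , r)) (<ᵇ-true r<p)

child-above : ∀ {t p r} → p ≤ r → child (t , p) r ≡ (suc t , r)
child-above {t} {p} {r} p≤r = cong (λ b → if b then (t , r) else (suc t , r)) (<ᵇ-false p≤r)

module GeneratingTree
  (τ : ℕ → ℕ → ℕ)
  (τ-≥ : ∀ {x y} → y < x → y ≤ τ x y)
  (τ-< : ∀ {n x y} → x < n → y < n → τ x y < n)
  (τ-allowed : ∀ e x → Descent.occurs τ e ≡ false → Descent.completes τ e x ≡ false →
               x < lastEntry e → Descent.completes τ e (τ (lastEntry e) x) ≡ false)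
  where

  open Descent τ

  avoids : List ℕ → Bool
  avoids e = not (occurs e)

  allowed : List ℕ → ℕ → Bool
  allowed e y = not (completes e y)

  label : List ℕ → Node
  label e = count< (allowed e) (suc (length e)) , count< (allowed e) (lastEntry e)

  allowed-fresh : ∀ {n} e → All (_< n) e → allowed e n ≡ true
  allowed-fresh []          _                   = refl
  allowed-fresh (a ∷ [])    _                   = refl
  allowed-fresh {n} (a ∷ b ∷ r) (a<n ∷ b<n ∷ r<n) =
    cong not (trans (cong (λ v → ((b <ᵇ a) ∧ v) ∨ completes (b ∷ r) n) (≡ᵇ-≢ (ℕP.>⇒≢ (τ-< a<n b<n))))
                    (trans (cong (_∨ completes (b ∷ r) n) (𝔹P.∧-zeroʳ (b <ᵇ a)))
                           (𝔹P.not-injective (allowed-fresh (b ∷ r) (b<n ∷ r<n)))))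

  allowed-ascent : ∀ e x → lastEntry e ≤ x → ∀ y → allowed (e ++ [ x ]) y ≡ allowed e y
  allowed-ascent e x last≤x y =
    cong not (trans (completes-snoc e x y)
                    (trans (cong (λ d → completes e y ∨ (d ∧ (y ≡ᵇ τ (lastEntry e) x))) (<ᵇ-false last≤x))
                           (𝔹P.∨-identityʳ (completes e y))))

  allowed-descent : ∀ e x → x < lastEntry e → ∀ y →
                    allowed (e ++ [ x ]) y ≡ (allowed e y ∧ not (y ≡ᵇ τ (lastEntry e) x))
  allowed-descent e x x<last y =
    trans (cong not (trans (completes-snoc e x y)
                           (cong (λ d → completes e y ∨ (d ∧ (y ≡ᵇ τ (lastEntry e) x))) (<ᵇ-true x<last))))
          (deMorgan (completes e y) (y ≡ᵇ τ (lastEntry e) x))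
    where
    deMorgan : ∀ a b → not (a ∨ b) ≡ (not a ∧ not b)
    deMorgan true  b = refl
    deMorgan false b = refl

  count-fresh : ∀ {n} e x → All (_< n) e → x < suc n →
    count< (allowed (e ++ [ x ])) (suc (suc n)) ≡ suc (count< (allowed (e ++ [ x ])) (suc n))
  count-fresh e x e<n x<1+n
    rewrite allowed-fresh (e ++ [ x ]) (AllP.++⁺ (All.map ℕP.m≤n⇒m≤1+n e<n) (x<1+n ∷ [])) = refl

  label-snoc : ∀ {n} e x → occurs e ≡ false → Bounded n e → allowed e x ≡ true → x < suc n →
    label (e ++ [ x ]) ≡ child (count< (allowed e) (suc n) , count< (allowed e) (lastEntry e)) (count< (allowed e) x)
  label-snoc {n} e x avoid (len , e<n) x-allowed x<1+n
    rewrite length-snoc e x | len | lastEntry-snoc e x | count-fresh e x e<n x<1+n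
    with ℕP.≤-<-connex (lastEntry e) x
  ... | inj₁ last≤x =
    trans (cong₂ (λ t r → suc t , r) (count<-cong (suc n) (λ y _ → allowed-ascent e x last≤x y))
                                     (count<-cong x (λ y _ → allowed-ascent e x last≤x y)))
          (sym (child-above (count<-mono (allowed e) last≤x)))
  ... | inj₂ x<last =
    trans (cong₂ _,_ (count<-remove (suc n) b b<1+n b-allowed b-forbidden others)
                     (count<-cong x (λ y y<x → others y (ℕP.<⇒≢ (ℕP.<-≤-trans y<x (τ-≥ x<last))))))
          (sym (child-below (count<-strict (allowed e) x-allowed x<last)))
    where
    b : ℕ
    b = τ (lastEntry e) x
    b<1+n : b < suc n
    b<1+n = τ-< (lastEntry-bound e e<n) x<1+n
    b-allowed : allowed e b ≡ true
    b-allowed = cong not (τ-allowed e x avoid (𝔹P.not-injective x-allowed) x<last)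
    b-forbidden : allowed (e ++ [ x ]) b ≡ false
    b-forbidden = trans (allowed-descent e x x<last b)
                        (trans (cong (λ v → allowed e b ∧ not v) (≡ᵇ-refl b)) (𝔹P.∧-zeroʳ (allowed e b)))
    others : ∀ y → y ≢ b → allowed (e ++ [ x ]) y ≡ allowed e y
    others y y≢b = trans (allowed-descent e x x<last y)
                         (trans (cong (λ v → allowed e y ∧ not v) (≡ᵇ-≢ y≢b)) (𝔹P.∧-identityʳ (allowed e y)))

  extensions-labels : ∀ {n} e → Bounded n e →
    map label (filterᵇ avoids (map (λ x → e ++ [ x ]) (upTo (suc n))))
      ≡ (if avoids e then children (label e) else [])
  extensions-labels {n} e (len , e<n) with occurs e in occ
  ... | true  = cong (map label)
      (trans (filterᵇ-map avoids (λ x → e ++ [ x ]) (upTo (suc n)))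
             (cong (map (λ x → e ++ [ x ]))
                   (filterᵇ-none _ (upTo (suc n)) (λ x → cong not (trans (occurs-snoc e x) (cong (_∨ completes e x) occ))))))
  ... | false = begin
    map label (filterᵇ avoids (map (λ x → e ++ [ x ]) (upTo (suc n))))
      ≡⟨ cong (map label) (trans (filterᵇ-map avoids (λ x → e ++ [ x ]) (upTo (suc n)))
                                 (cong (map (λ x → e ++ [ x ])) (filterᵇ-cong extension-avoids (upTo (suc n))))) ⟩
    map label (map (λ x → e ++ [ x ]) (filterᵇ (allowed e) (upTo (suc n))))
      ≡⟨ sym (ℒP.map-∘ (filterᵇ (allowed e) (upTo (suc n)))) ⟩
    map (λ x → label (e ++ [ x ])) (filterᵇ (allowed e) (upTo (suc n)))
      ≡⟨ map-congAll (filterᵇ-All (allowed e) (AllP.all-upTo (suc n)))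
                     (λ { {x} (x-allowed , x<1+n) → label-snoc e x occ (len , e<n) x-allowed x<1+n }) ⟩
    map (λ x → child (t , p) (count< (allowed e) x)) (filterᵇ (allowed e) (upTo (suc n)))
      ≡⟨ rank (allowed e) (suc n) (child (t , p)) ⟩
    children (t , p)
      ≡⟨ cong (λ m → children (count< (allowed e) (suc m) , p)) (sym len) ⟩
    children (label e) ∎
    where
    open ≡-Reasoning
    t p : ℕ
    t = count< (allowed e) (suc n)
    p = count< (allowed e) (lastEntry e)
    extension-avoids : ∀ x → avoids (e ++ [ x ]) ≡ allowed e x
    extension-avoids x = cong not (trans (occurs-snoc e x) (cong (_∨ completes e x) occ))

  labels-step : ∀ {n} (es : List (List ℕ)) → All (Bounded n) es →
    concatMap (λ e → map label (filterᵇ avoids (map (λ x → e ++ [ x ]) (upTo (suc n))))) es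
      ≡ concatMap (children ∘ label) (filterᵇ avoids es)
  labels-step []       []           = refl
  labels-step (e ∷ es) (be ∷ bes) rewrite extensions-labels e be with avoids e
  ... | true  = cong (children (label e) ++_) (labels-step es bes)
  ... | false = labels-step es bes

  labels-level : ∀ n → map label (filterᵇ avoids (invSeqs n)) ≡ level n
  labels-level zero    = refl
  labels-level (suc n) = begin
    map label (filterᵇ avoids (concatMap extend (invSeqs n)))
      ≡⟨ cong (map label) (filterᵇ-concatMap avoids extend (invSeqs n)) ⟩
    map label (concatMap (filterᵇ avoids ∘ extend) (invSeqs n))
      ≡⟨ ℒP.map-concatMap label (filterᵇ avoids ∘ extend) (invSeqs n) ⟩
    concatMap (map label ∘ filterᵇ avoids ∘ extend) (invSeqs n)
      ≡⟨ labels-step (invSeqs n) (invSeqs-bounded n) ⟩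
    concatMap (children ∘ label) (filterᵇ avoids (invSeqs n))
      ≡⟨ sym (ℒP.concatMap-map children label (filterᵇ avoids (invSeqs n))) ⟩
    concatMap children (map label (filterᵇ avoids (invSeqs n)))
      ≡⟨ cong (concatMap children) (labels-level n) ⟩
    level (suc n) ∎
    where
    open ≡-Reasoning
    extend : List ℕ → List (List ℕ)
    extend e = map (λ x → e ++ [ x ]) (upTo (suc n))

  count-level : ∀ n → length (filterᵇ avoids (invSeqs n)) ≡ length (level n)
  count-level n = trans (sym (ℒP.length-map label (filterᵇ avoids (invSeqs n)))) (cong length (labels-level n))

module Pattern100 = Descent (λ x y → y)
module Pattern101 = Descent (λ x y → x)

contains100-occurs : ∀ e → contains100 e ≡ Pattern100.occurs e
contains100-occurs []             = refl
contains100-occurs (x ∷ [])       = refl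
contains100-occurs (x ∷ y ∷ rest) =
  cong (((y <ᵇ x) ∧ any (λ w → w ≡ᵇ y) rest) ∨_) (contains100-occurs (y ∷ rest))

contains101-occurs : ∀ e → contains101 e ≡ Pattern101.occurs e
contains101-occurs []             = refl
contains101-occurs (x ∷ [])       = refl
contains101-occurs (x ∷ y ∷ rest) =
  cong (((y <ᵇ x) ∧ any (λ w → w ≡ᵇ x) rest) ∨_) (contains101-occurs (y ∷ rest))

∨-false : ∀ {a b} → (a ∨ b) ≡ false → a ≡ false × b ≡ false
∨-false {false} b≡false = refl , b≡false

any-lastEntry : ∀ a c r → (lastEntry (c ∷ r) ≡ᵇ a) ≡ true → any (λ w → w ≡ᵇ a) (c ∷ r) ≡ true
any-lastEntry a c []      last≡a = trans (cong (_∨ false) last≡a) refl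
any-lastEntry a c (d ∷ r) last≡a = trans (cong ((c ≡ᵇ a) ∨_) (any-lastEntry a d r last≡a)) (𝔹P.∨-zeroʳ (c ≡ᵇ a))

repeat-last-allowed : ∀ e → Pattern101.occurs e ≡ false → Pattern101.completes e (lastEntry e) ≡ false
repeat-last-allowed []          _     = refl
repeat-last-allowed (a ∷ [])    _     = refl
repeat-last-allowed (a ∷ b ∷ r) avoid =
  trans (cong (((b <ᵇ a) ∧ (lastEntry (b ∷ r) ≡ᵇ a)) ∨_)
              (repeat-last-allowed (b ∷ r) (proj₂ (∨-false avoid))))
        (trans (𝔹P.∨-identityʳ _) (no-descent-to-last r (proj₁ (∨-false avoid))))
  where
  no-descent-to-last : ∀ r → ((b <ᵇ a) ∧ any (λ w → w ≡ᵇ a) r) ≡ false →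
                       ((b <ᵇ a) ∧ (lastEntry (b ∷ r) ≡ᵇ a)) ≡ false
  no-descent-to-last []      _ = descent-unequal a b
    where
    descent-unequal : ∀ a b → ((b <ᵇ a) ∧ (b ≡ᵇ a)) ≡ false
    descent-unequal zero    zero    = refl
    descent-unequal (suc a) zero    = refl
    descent-unequal zero    (suc b) = refl
    descent-unequal (suc a) (suc b) = descent-unequal a b
  no-descent-to-last (c ∷ r) no-occurrence with lastEntry (c ∷ r) ≡ᵇ a in last≡a
  ... | false = 𝔹P.∧-zeroʳ (b <ᵇ a)
  ... | true  = trans (cong ((b <ᵇ a) ∧_) (sym (any-lastEntry a c r last≡a))) no-occurrence

module Tree100 = GeneratingTree (λ x y → y) (λ _ → ℕP.≤-refl) (λ _ y<n → y<n)
                               (λ e x _ x-free _ → x-free)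
module Tree101 = GeneratingTree (λ x y → x) ℕP.<⇒≤ (λ x<n _ → x<n)
                               (λ e x avoid _ _ → repeat-last-allowed e avoid)

count100-level : ∀ n → count100 n ≡ length (level n)
count100-level n =
  trans (cong length (filterᵇ-cong (λ e → cong not (contains100-occurs e)) (invSeqs n)))
        (Tree100.count-level n)

count101-level : ∀ n → count101 n ≡ length (level n)
count101-level n =
  trans (cong length (filterᵇ-cong (λ e → cong not (contains101-occurs e)) (invSeqs n)))
        (Tree101.count-level n)

-- Every solution G of the functional equation equals T, so it has
-- finitely many u-terms in each zⁿ and G(1, z) counts the tree levels.

solution-support : ∀ G → IsG G → ∀ n i → suc n < i → G i n ≡ + 0
solution-support G isG n i n+1<i = trans (isG-unique G treeGF isG tree-isG i n) (tree-support n i n+1<i)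

solution-total : ∀ G → IsG G → ∀ n → sumTo (suc n) (λ i → G i n) ≡ + length (level n)
solution-total G isG n =
  trans (sumTo-cong′ (suc n) (λ i → isG-unique G treeGF isG tree-isG i n)) (tree-total n)

proposition3p12 : Σ Series IsG
    × ((G : Series) → IsG G → (n : ℕ) →
        Σ ℕ (λ N → ((i : ℕ) → N < i → G i n ≡ + 0)
          × (sumTo N (λ i → G i n) ≡ + count100 n)
          × (sumTo N (λ i → G i n) ≡ + count101 n)))
proposition3p12 =
  (treeGF , tree-isG) ,
  λ G isG n → suc n , solution-support G isG n
                    , trans (solution-total G isG n) (cong +_ (sym (count100-level n)))
                    , trans (solution-total G isG n) (cong +_ (sym (count101-level n)))
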